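{- Let $$G(x,y,z)=\sum_{\ell,m,k\ge0}\binom{k+\ell+m}{k+\ell}\binom{2k+\ell+m-1}{k+\ell+m-1}x^ky^\ell z^m$$ (with the coefficient $\binom{ -1}{ -1}$ occurring for $k=\ell=m=0$ taken to be $1$) and $$g(x,z)=\sum_{m,k\ge0}\binom{m+k}{k}\binom{2k+m}{k}x^kz^m,$$ as formal power series. Then $G(x,x,z)=g(x,z)$. -}

module Defs where

open import Data.Nat using (ℕ; zero; suc; _+_; _*_; _∸_)
open import Data.Nat.Combinatorics using (_C_)
open import Data.List using (map; upTo)
open import Data.Nat.ListAction using (sum)

-- Formal power series with natural-number coefficients, represented by
-- their coefficient functions.
-- PS3 : coefficient of x^k y^l z^m is  F k l m.
-- PS2 : coefficient of x^k z^m     is  f k m.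
PS3 : Set
PS3 = ℕ → ℕ → ℕ → ℕ

PS2 : Set
PS2 = ℕ → ℕ → ℕ

Gcoeff : PS3
Gcoeff zero zero zero = 1
Gcoeff k l m = ((k + l + m) C (k + l)) * ((2 * k + l + m ∸ 1) C (k + l + m ∸ 1))

gcoeff : PS2
gcoeff k m = ((m + k) C k) * ((2 * k + m) C k)

-- Substitution y := x in a series F(x,y,z):
-- coefficient of x^n z^m in F(x,x,z) is  Σ_{k=0}^{n} F k (n-k) m.
substYx : PS3 → PS2
substYx F n m = sum (map (λ k → F k (n ∸ k) m) (upTo (suc n)))

{-# OPTIONS --safe #-}
module Submission where

-- Putting y = x, the coefficient of x^n z^m in G(x,x,z) is the sum over k + l = n of the
-- coefficients of x^k y^l z^m. There the first binomial C(n+m, n) does not depend on k and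
-- the second one is C(k+p, p) with p = n+m-1, so the hockey-stick identity
-- Σ_{k≤n} C(k+p, p) = C(n+p+1, p+1) = C(2n+m, n) gives exactly the coefficient of g.

open import Defs
open import Data.Nat using (ℕ; zero; suc; _+_; _*_; _∸_; _<_; _≤_; s≤s⁻¹)
open import Data.Nat.Properties
  using (+-identityʳ; +-comm; +-suc; *-zeroʳ; *-distribˡ-+; m<n⇒m<1+n; n<1+n; m≤n+m; m+n∸n≡m; m+[n∸m]≡n)
open import Data.Nat.Combinatorics using (_C_; k>n⇒nCk≡0; nCk≡nC[n∸k]; nCk+nC[k+1]≡[n+1]C[k+1])
open import Data.Nat.Solver using (module +-*-Solver)
open import Data.List using (map; upTo; _++_; [_])
open import Data.List.Properties using (upTo-∷ʳ; map-++)
open import Data.Nat.ListAction using (sum)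
open import Data.Nat.ListAction.Properties using (sum-++)
open import Relation.Binary.PropositionalEquality using (_≡_; refl; sym; cong; cong₂; module ≡-Reasoning)
open +-*-Solver using (solve; _:+_; _:*_; _:=_; con)
open ≡-Reasoning

sumUpTo : (ℕ → ℕ) → ℕ → ℕ
sumUpTo f n = sum (map f (upTo n))

sumUpTo-suc : ∀ f n → sumUpTo f (suc n) ≡ sumUpTo f n + f n
sumUpTo-suc f n = begin
  sum (map f (upTo (suc n)))       ≡⟨ cong (λ ks → sum (map f ks)) (upTo-∷ʳ n) ⟨
  sum (map f (upTo n ++ [ n ]))    ≡⟨ cong sum (map-++ f (upTo n) [ n ]) ⟩
  sum (map f (upTo n) ++ [ f n ])  ≡⟨ sum-++ (map f (upTo n)) [ f n ] ⟩
  sumUpTo f n + (f n + 0)          ≡⟨ cong (sumUpTo f n +_) (+-identityʳ (f n)) ⟩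
  sumUpTo f n + f n                ∎

sumUpTo-cong : ∀ {f g} n → (∀ {k} → k < n → f k ≡ g k) → sumUpTo f n ≡ sumUpTo g n
sumUpTo-cong zero            f≗g = refl
sumUpTo-cong {f} {g} (suc n) f≗g = begin
  sumUpTo f (suc n)  ≡⟨ sumUpTo-suc f n ⟩
  sumUpTo f n + f n  ≡⟨ cong₂ _+_ (sumUpTo-cong n (λ k<n → f≗g (m<n⇒m<1+n k<n))) (f≗g (n<1+n n)) ⟩
  sumUpTo g n + g n  ≡⟨ sumUpTo-suc g n ⟨
  sumUpTo g (suc n)  ∎

sumUpTo-*ˡ : ∀ c f n → sumUpTo (λ k → c * f k) n ≡ c * sumUpTo f n
sumUpTo-*ˡ c f zero    = sym (*-zeroʳ c)
sumUpTo-*ˡ c f (suc n) = begin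
  sumUpTo (λ k → c * f k) (suc n)      ≡⟨ sumUpTo-suc (λ k → c * f k) n ⟩
  sumUpTo (λ k → c * f k) n + c * f n  ≡⟨ cong (_+ c * f n) (sumUpTo-*ˡ c f n) ⟩
  c * sumUpTo f n + c * f n            ≡⟨ *-distribˡ-+ c (sumUpTo f n) (f n) ⟨
  c * (sumUpTo f n + f n)              ≡⟨ cong (c *_) (sumUpTo-suc f n) ⟨
  c * sumUpTo f (suc n)                ∎

hockey-stick : ∀ p n → sumUpTo (λ k → (k + p) C p) n ≡ (n + p) C suc p
hockey-stick p zero    = sym (k>n⇒nCk≡0 (n<1+n p))
hockey-stick p (suc n) = begin
  sumUpTo (λ k → (k + p) C p) (suc n)           ≡⟨ sumUpTo-suc (λ k → (k + p) C p) n ⟩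
  sumUpTo (λ k → (k + p) C p) n + (n + p) C p   ≡⟨ cong (_+ (n + p) C p) (hockey-stick p n) ⟩
  (n + p) C suc p + (n + p) C p                 ≡⟨ +-comm ((n + p) C suc p) ((n + p) C p) ⟩
  (n + p) C p + (n + p) C suc p                 ≡⟨ nCk+nC[k+1]≡[n+1]C[k+1] (n + p) p ⟩
  suc (n + p) C suc p                           ∎

[m+n]Cn≡[m+n]Cm : ∀ m n → (m + n) C n ≡ (m + n) C m
[m+n]Cn≡[m+n]Cm m n = begin
  (m + n) C n            ≡⟨ nCk≡nC[n∸k] (m≤n+m n m) ⟩
  (m + n) C (m + n ∸ n)  ≡⟨ cong ((m + n) C_) (m+n∸n≡m m n) ⟩
  (m + n) C m            ∎

-- The exceptional value C(-1,-1) := 1 at k = l = m = 0 is also what truncated subtraction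
-- produces there, as (0 ∸ 1) C (0 ∸ 1) = 0 C 0 = 1.
Gcoeff≡binomials : ∀ k l m → Gcoeff k l m ≡ ((k + l + m) C (k + l)) * ((2 * k + l + m ∸ 1) C (k + l + m ∸ 1))
Gcoeff≡binomials zero    zero    zero    = refl
Gcoeff≡binomials zero    zero    (suc m) = refl
Gcoeff≡binomials zero    (suc l) m       = refl
Gcoeff≡binomials (suc k) l       m       = refl

Gcoeff-antidiagonal : ∀ {k n m p} → k ≤ n → n + m ≡ suc p →
                      Gcoeff k (n ∸ k) m ≡ ((n + m) C n) * ((k + p) C p)
Gcoeff-antidiagonal {k} {n} {m} {p} k≤n n+m≡1+p = begin
  Gcoeff k l m
    ≡⟨ Gcoeff≡binomials k l m ⟩
  ((k + l + m) C (k + l)) * ((2 * k + l + m ∸ 1) C (k + l + m ∸ 1))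
    ≡⟨ cong (λ t → ((k + l + m) C (k + l)) * ((t ∸ 1) C (k + l + m ∸ 1))) ([2k+l+m]≡k+[k+l+m] k l m) ⟩
  ((k + l + m) C (k + l)) * ((k + (k + l + m) ∸ 1) C (k + l + m ∸ 1))
    ≡⟨ cong (λ s → ((s + m) C s) * ((k + (s + m) ∸ 1) C (s + m ∸ 1))) (m+[n∸m]≡n k≤n) ⟩
  ((n + m) C n) * ((k + (n + m) ∸ 1) C (n + m ∸ 1))
    ≡⟨ cong (λ s → ((n + m) C n) * ((k + s ∸ 1) C (s ∸ 1))) n+m≡1+p ⟩
  ((n + m) C n) * ((k + suc p ∸ 1) C p)
    ≡⟨ cong (λ t → ((n + m) C n) * ((t ∸ 1) C p)) (+-suc k p) ⟩
  ((n + m) C n) * ((k + p) C p)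
    ∎
  where
  l = n ∸ k
  [2k+l+m]≡k+[k+l+m] : ∀ k l m → 2 * k + l + m ≡ k + (k + l + m)
  [2k+l+m]≡k+[k+l+m] = solve 3 (λ k l m → con 2 :* k :+ l :+ m := k :+ (k :+ l :+ m)) refl

substYx-Gcoeff : ∀ n m {p} → n + m ≡ suc p → substYx Gcoeff n m ≡ gcoeff n m
substYx-Gcoeff n m {p} n+m≡1+p = begin
  sumUpTo (λ k → Gcoeff k (n ∸ k) m) (suc n)
    ≡⟨ sumUpTo-cong (suc n) (λ k<1+n → Gcoeff-antidiagonal (s≤s⁻¹ k<1+n) n+m≡1+p) ⟩
  sumUpTo (λ k → ((n + m) C n) * ((k + p) C p)) (suc n)
    ≡⟨ sumUpTo-*ˡ ((n + m) C n) (λ k → (k + p) C p) (suc n) ⟩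
  ((n + m) C n) * sumUpTo (λ k → (k + p) C p) (suc n)
    ≡⟨ cong (((n + m) C n) *_) (hockey-stick p (suc n)) ⟩
  ((n + m) C n) * ((suc n + p) C suc p)
    ≡⟨ cong (λ s → ((n + m) C n) * (s C suc p)) (+-suc n p) ⟨
  ((n + m) C n) * ((n + suc p) C suc p)
    ≡⟨ cong₂ _*_ (cong (_C n) (+-comm n m)) ([m+n]Cn≡[m+n]Cm n (suc p)) ⟩
  ((m + n) C n) * ((n + suc p) C n)
    ≡⟨ cong (λ s → ((m + n) C n) * (s C n)) n+[1+p]≡2n+m ⟩
  gcoeff n m
    ∎
  where
  n+[1+p]≡2n+m : n + suc p ≡ 2 * n + m
  n+[1+p]≡2n+m = begin
    n + suc p    ≡⟨ cong (n +_) n+m≡1+p ⟨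
    n + (n + m)  ≡⟨ solve 2 (λ n m → n :+ (n :+ m) := con 2 :* n :+ m) refl n m ⟩
    2 * n + m    ∎

lemma6 : (n m : ℕ) → substYx Gcoeff n m ≡ gcoeff n m
lemma6 zero    zero    = refl
lemma6 zero    (suc m) = substYx-Gcoeff zero (suc m) refl
lemma6 (suc n) m       = substYx-Gcoeff (suc n) m refl
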